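{- Let $\alpha\in\mathbb Z\setminus\{0,1\}$ and let $(h_n)$ be the sequence with $h_0=0$, $h_1=1$, $h_2=-\alpha^2(\alpha-1)$, $h_3=-\alpha^6(\alpha-1)^3$, $h_4=\alpha^{11}(\alpha-1)^6$, and for $m\ge2$: $h_{2m+1}=h_{m+2}h_m^3-h_{m-1}h_{m+1}^3$, for $m\ge 3$: $h_{2m}=h_m\big(h_{m+2}h_{m-1}^2-h_{m-2}h_{m+1}^2\big)/h_2$. (i) If $n\equiv 2,3,11,12\pmod{14}$, then $h_n$ is a square if and only if $\alpha-1$ is a square. (ii) If $n\equiv 4,5,9,10\pmod{14}$, then $h_n$ is a square if and only if $\alpha$ is a square. (iii) If $n\equiv 4,6,10,11,15,17\pmod{21}$, then $h_n$ is a cube if and only if $\alpha$ is a cube. (iv) If $n\equiv 9,12\pmod{21}$, then $h_n$ is a cube if and only if $\alpha-1$ is a cube.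
   Context: The sequence defined is the elliptic divisibility sequence attached to the point $(0,0)$ of order $7$ on the Tate normal form curve with $b=\alpha^3-\alpha^2$, $c=\alpha^2-\alpha$. Convention: an integer $m$ is called a square if $m=\pm\beta^2$ for some nonzero integer $\beta$, and a cube if $m=\beta^3$ for some nonzero integer $\beta$. -}

module Defs where

open import Data.Nat as ℕ using (ℕ; zero; suc; _∸_; ⌊_/2⌋; _%_)
open import Data.Integer using (ℤ; +_; -[1+_]; _+_; _-_; _*_; -_; _^_; _/_)
open import Data.Product using (∃; _×_)
open import Data.Sum using (_⊎_)
open import Relation.Binary.PropositionalEquality using (_≡_; _≢_)

-- Integer division by d; only ever used with d = h₂ ≠ 0 (α ∉ {0,1}),
-- where the division is exact. Returns 0 for d = 0 (never happens).
_÷_ : ℤ → ℤ → ℤ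
a ÷ (+ zero)    = + 0
a ÷ (+ suc k)   = a / (+ suc k)
a ÷ (-[1+ k ])  = a / (-[1+ k ])

h2 h3 h4 : ℤ → ℤ
h2 α = - (α ^ 2 * (α - + 1))
h3 α = - (α ^ 6 * (α - + 1) ^ 3)
h4 α = α ^ 11 * (α - + 1) ^ 6

-- Fuel-driven version of the recursion (fuel only guarantees termination;
-- every recursive call is at a strictly smaller index).
hF : ℤ → ℕ → ℕ → ℤ
hF α zero n = + 0
hF α (suc f) 0 = + 0
hF α (suc f) 1 = + 1
hF α (suc f) 2 = h2 α
hF α (suc f) 3 = h3 α
hF α (suc f) 4 = h4 α
hF α (suc f) n@(suc (suc (suc (suc (suc k))))) with n % 2
... | zero =
  let m = ⌊ n /2⌋ ; h = hF α f in
  (h m * (h (m ℕ.+ 2) * h (m ∸ 1) ^ 2 - h (m ∸ 2) * h (m ℕ.+ 1) ^ 2)) ÷ h2 α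
... | suc _ =
  let m = ⌊ n /2⌋ ; h = hF α f in
  h (m ℕ.+ 2) * h m ^ 3 - h (m ∸ 1) * h (m ℕ.+ 1) ^ 3

h : ℤ → ℕ → ℤ
h α n = hF α (suc n) n

IsSquare : ℤ → Set
IsSquare m = ∃ λ β → β ≢ + 0 × (m ≡ β ^ 2 ⊎ m ≡ - (β ^ 2))

IsCube : ℤ → Set
IsCube m = ∃ λ β → β ≢ + 0 × m ≡ β ^ 3

module Submission where

-- For α ∉ {0, 1} the sequence has the closed form
--   h_n = sgn(n) · α^eα(n) · (α-1)^eβ(n),
-- where sgn(n) ∈ {0, ±1} has period 7 (h₇ = 0) and the exponents are quasi-quadratic:
-- eα(n+7) = eα(n) + 5(2n+7) and eβ(n+7) = eβ(n) + 3(2n+7), so that shifting n by 7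
-- multiplies h_n by γ^(2n+7) with γ = α⁵(α-1)³. The closed form satisfies both recurrences:
-- for the fourteen smallest instances by comparing explicit monomials, and in general because
-- the shift by 7 rescales all terms by powers of γ whose exponents balance. Induction on the
-- fuel of `hF` then identifies h with the closed form (the even step divides exactly by h₂ ≠ 0).
-- On a residue class of n modulo 14 (resp. 21) the exponents are constant modulo 2 (resp. 3),
-- so h_n = ±M·W^k with W ≠ 0 and M one of α, α², α - 1; a unit sign and a nonzero k-th power
-- factor do not change being a square or a cube (a gcd argument on absolute values).

open import Defs
open import Data.Nat as ℕ using (ℕ; zero; suc; _%_; _≤_; _<_; s≤s; z≤n; ⌊_/2⌋; NonZero; ≢-nonZero)
import Data.Nat.Properties as ℕP
open import Data.Nat.Divisibility using (_∣_; divides; ∣-trans; m∣m*n; ∣1⇒≡1; *-cancelʳ-∣)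
open import Data.Nat.GCD using (gcd; gcd[m,n]∣m; gcd[m,n]∣n; gcd[m,n]≢0)
open import Data.Nat.Coprimality using (Coprime; coprime-divisor; coprime-/gcd)
  renaming (sym to coprime-sym)
import Data.Nat.DivMod as ℕD
open import Data.Nat.Tactic.RingSolver using () renaming (solve-∀ to ℕ-solve)
open import Data.Integer as ℤ using (ℤ; +_; -[1+_]; _+_; _-_; _*_; -_; _^_; ∣_∣; _/ℕ_)
import Data.Integer.Properties as ℤP
import Data.Integer.DivMod as ℤDM
open import Data.Integer.Solver using (module +-*-Solver)
open +-*-Solver
open import Data.Product using (∃; ∃₂; _×_; _,_; proj₁; proj₂)
open import Data.Sum using (_⊎_; inj₁; inj₂)
import Data.Sum as Sum
open import Data.Empty using (⊥-elim)
open import Function.Base using (_∘_)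
open import Function.Bundles using (_⇔_; mk⇔; Equivalence)
open import Function.Properties.Equivalence using () renaming (trans to ⇔-trans)
open import Relation.Binary.PropositionalEquality

^-distribʳ-* : ∀ x y n → (x ℕ.* y) ℕ.^ n ≡ x ℕ.^ n ℕ.* y ℕ.^ n
^-distribʳ-* x y zero = refl
^-distribʳ-* x y (suc n) =
  trans (cong (x ℕ.* y ℕ.*_) (^-distribʳ-* x y n)) (interchange x y (x ℕ.^ n) (y ℕ.^ n))
  where
  interchange : ∀ a b c d → a ℕ.* b ℕ.* (c ℕ.* d) ≡ a ℕ.* c ℕ.* (b ℕ.* d)
  interchange = ℕ-solve

coprime-∣-power : ∀ {b a} → Coprime b a → ∀ n → b ∣ a ℕ.^ n → b ∣ 1
coprime-∣-power b⊥a zero b∣1 = b∣1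
coprime-∣-power b⊥a (suc n) b∣aⁿ⁺¹ = coprime-∣-power b⊥a n (coprime-divisor b⊥a b∣aⁿ⁺¹)

-- Divisibility between (k+1)-th powers descends to the bases: writing a = a′g,
-- b = b′g with g = gcd a b, the coprime b′ must divide 1, so b = g divides a.
^-cancel-∣ : ∀ k {a b} → b ≢ 0 → b ℕ.^ suc k ∣ a ℕ.^ suc k → b ∣ a
^-cancel-∣ k {a} {b} b≢0 bᵏ∣aᵏ = subst (_∣ a) (sym b≡g) (gcd[m,n]∣m a b)
  where
  g : ℕ
  g = gcd a b
  instance
    g≢0 : NonZero g
    g≢0 = ≢-nonZero (gcd[m,n]≢0 a b (inj₂ b≢0))
    gᵏ≢0 : NonZero (g ℕ.^ suc k)
    gᵏ≢0 = ℕP.m^n≢0 g (suc k)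
  a′ b′ : ℕ
  a′ = a ℕ./ g
  b′ = b ℕ./ g
  a≡a′g : a ≡ a′ ℕ.* g
  a≡a′g = sym (ℕD.m/n*n≡m (gcd[m,n]∣m a b))
  b≡b′g : b ≡ b′ ℕ.* g
  b≡b′g = sym (ℕD.m/n*n≡m (gcd[m,n]∣n a b))
  power-of : ∀ {x} x′ → x ≡ x′ ℕ.* g → x ℕ.^ suc k ≡ x′ ℕ.^ suc k ℕ.* g ℕ.^ suc k
  power-of x′ x≡x′g = trans (cong (ℕ._^ suc k) x≡x′g) (^-distribʳ-* x′ g (suc k))
  b′ᵏ∣a′ᵏ : b′ ℕ.^ suc k ∣ a′ ℕ.^ suc k
  b′ᵏ∣a′ᵏ = *-cancelʳ-∣ (g ℕ.^ suc k) (subst₂ _∣_ (power-of b′ b≡b′g) (power-of a′ a≡a′g) bᵏ∣aᵏ)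
  b′≡1 : b′ ≡ 1
  b′≡1 = ∣1⇒≡1 (coprime-∣-power (coprime-sym (coprime-/gcd a b)) (suc k)
                  (∣-trans (m∣m*n (b′ ℕ.^ k)) b′ᵏ∣a′ᵏ))
  b≡g : b ≡ g
  b≡g = trans b≡b′g (trans (cong (ℕ._* g) b′≡1) (ℕP.*-identityˡ g))

quotient-power : ∀ k x w c → w ≢ 0 → x ℕ.* w ℕ.^ suc k ≡ c ℕ.^ suc k → ∃ λ q → x ≡ q ℕ.^ suc k
quotient-power k x w c w≢0 xwᵏ≡cᵏ with ^-cancel-∣ k {c} w≢0 (divides x (sym xwᵏ≡cᵏ))
... | divides q c≡qw = q , ℕP.*-cancelʳ-≡ x (q ℕ.^ suc k) (w ℕ.^ suc k) xwᵏ≡qᵏwᵏ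
  where
  instance
    wᵏ≢0 : NonZero (w ℕ.^ suc k)
    wᵏ≢0 = ℕP.m^n≢0 w (suc k) {{≢-nonZero w≢0}}
  xwᵏ≡qᵏwᵏ : x ℕ.* w ℕ.^ suc k ≡ q ℕ.^ suc k ℕ.* w ℕ.^ suc k
  xwᵏ≡qᵏwᵏ = trans xwᵏ≡cᵏ (trans (cong (ℕ._^ suc k) c≡qw) (^-distribʳ-* q w (suc k)))

pos-^ : ∀ q n → (+ q) ^ n ≡ + (q ℕ.^ n)
pos-^ q zero = refl
pos-^ q (suc n) = trans (cong (+ q *_) (pos-^ q n)) (sym (ℤP.pos-* q (q ℕ.^ n)))

abs-^ : ∀ i n → ∣ i ^ n ∣ ≡ ∣ i ∣ ℕ.^ n
abs-^ i zero = refl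
abs-^ i (suc n) = trans (ℤP.abs-* i (i ^ n)) (cong (∣ i ∣ ℕ.*_) (abs-^ i n))

±abs : ∀ x → x ≡ + ∣ x ∣ ⊎ x ≡ - (+ ∣ x ∣)
±abs (+ n) = inj₁ refl
±abs -[1+ n ] = inj₂ refl

*-nonzero : ∀ {x y} → x ≢ + 0 → y ≢ + 0 → x * y ≢ + 0
*-nonzero {x} x≢0 y≢0 xy≡0 with ℤP.i*j≡0⇒i≡0∨j≡0 x xy≡0
... | inj₁ x≡0 = x≢0 x≡0
... | inj₂ y≡0 = y≢0 y≡0

^-nonzero : ∀ {x} n → x ≢ + 0 → x ^ n ≢ + 0
^-nonzero {x} n x≢0 xⁿ≡0 = x≢0 (ℤP.i^n≡0⇒i≡0 x n xⁿ≡0)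

neg-nonzero : ∀ {x} → x ≢ + 0 → - x ≢ + 0
neg-nonzero {x} x≢0 -x≡0 = x≢0 (trans (sym (ℤP.neg-involutive x)) (cong -_ -x≡0))

signed-power : ∀ k x w c → w ≢ + 0 → c ≢ + 0 → ∣ x * w ^ suc k ∣ ≡ ∣ c ^ suc k ∣ →
  ∃ λ q → + q ≢ + 0 × (x ≡ (+ q) ^ suc k ⊎ x ≡ - ((+ q) ^ suc k))
signed-power k x w c w≢0 c≢0 abs≡ =
  q , q≢0 , Sum.map (λ x≡ → trans x≡ +∣x∣≡qᵏ) (λ x≡ → trans x≡ (cong -_ +∣x∣≡qᵏ)) (±abs x)
  where
  ∣x∣∣w∣ᵏ≡∣c∣ᵏ : ∣ x ∣ ℕ.* ∣ w ∣ ℕ.^ suc k ≡ ∣ c ∣ ℕ.^ suc k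
  ∣x∣∣w∣ᵏ≡∣c∣ᵏ = begin
    ∣ x ∣ ℕ.* ∣ w ∣ ℕ.^ suc k ≡⟨ cong (∣ x ∣ ℕ.*_) (abs-^ w (suc k)) ⟨
    ∣ x ∣ ℕ.* ∣ w ^ suc k ∣   ≡⟨ ℤP.abs-* x (w ^ suc k) ⟨
    ∣ x * w ^ suc k ∣         ≡⟨ abs≡ ⟩
    ∣ c ^ suc k ∣             ≡⟨ abs-^ c (suc k) ⟩
    ∣ c ∣ ℕ.^ suc k           ∎
    where open ≡-Reasoning
  root : ∃ λ q → ∣ x ∣ ≡ q ℕ.^ suc k
  root = quotient-power k (∣ x ∣) (∣ w ∣) (∣ c ∣) (w≢0 ∘ ℤP.∣i∣≡0⇒i≡0) ∣x∣∣w∣ᵏ≡∣c∣ᵏ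
  q : ℕ
  q = proj₁ root
  +∣x∣≡qᵏ : + ∣ x ∣ ≡ (+ q) ^ suc k
  +∣x∣≡qᵏ = trans (cong +_ (proj₂ root)) (sym (pos-^ q (suc k)))
  -- q = 0 would force |c|^(k+1) = 0
  q≢0 : + q ≢ + 0
  q≢0 +q≡0 = c≢0 (ℤP.∣i∣≡0⇒i≡0 (ℕP.m^n≡0⇒m≡0 ∣ c ∣ (suc k) (begin
    ∣ c ∣ ℕ.^ suc k           ≡⟨ ∣x∣∣w∣ᵏ≡∣c∣ᵏ ⟨
    ∣ x ∣ ℕ.* ∣ w ∣ ℕ.^ suc k ≡⟨ cong (ℕ._* ∣ w ∣ ℕ.^ suc k) (proj₂ root) ⟩
    q ℕ.^ suc k ℕ.* ∣ w ∣ ℕ.^ suc k ≡⟨ cong (λ z → z ℕ.^ suc k ℕ.* ∣ w ∣ ℕ.^ suc k) (ℤP.+-injective +q≡0) ⟩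
    0                         ∎)))
    where open ≡-Reasoning

≡⇒⇔ : ∀ (P : ℤ → Set) {x y} → x ≡ y → P x ⇔ P y
≡⇒⇔ P x≡y = mk⇔ (subst P x≡y) (subst P (sym x≡y))

square-scale : ∀ {x w} → w ≢ + 0 → IsSquare (x * w ^ 2) ⇔ IsSquare x
square-scale {x} {w} w≢0 = mk⇔ to from
  where
  root-is-square : (∃ λ q → + q ≢ + 0 × (x ≡ (+ q) ^ 2 ⊎ x ≡ - ((+ q) ^ 2))) → IsSquare x
  root-is-square (q , q≢0 , x≡±q²) = + q , q≢0 , x≡±q²
  product-square : ∀ b w → b ^ 2 * w ^ 2 ≡ (b * w) ^ 2
  product-square = solve 2 (λ b w → b :^ 2 :* w :^ 2 := (b :* w) :^ 2) refl
  neg-product-square : ∀ b w → - (b ^ 2) * w ^ 2 ≡ - ((b * w) ^ 2)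
  neg-product-square = solve 2 (λ b w → (:- (b :^ 2)) :* w :^ 2 := :- ((b :* w) :^ 2)) refl
  to : IsSquare (x * w ^ 2) → IsSquare x
  to (c , c≢0 , inj₁ xw²≡c²) = root-is-square (signed-power 1 x w c w≢0 c≢0 (cong ∣_∣ xw²≡c²))
  to (c , c≢0 , inj₂ xw²≡-c²) = root-is-square
    (signed-power 1 x w c w≢0 c≢0 (trans (cong ∣_∣ xw²≡-c²) (ℤP.∣-i∣≡∣i∣ (c ^ 2))))
  from : IsSquare x → IsSquare (x * w ^ 2)
  from (b , b≢0 , inj₁ x≡b²) =
    b * w , *-nonzero b≢0 w≢0 , inj₁ (trans (cong (_* w ^ 2) x≡b²) (product-square b w))
  from (b , b≢0 , inj₂ x≡-b²) =
    b * w , *-nonzero b≢0 w≢0 , inj₂ (trans (cong (_* w ^ 2) x≡-b²) (neg-product-square b w))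

square-neg : ∀ {x} → IsSquare (- x) ⇔ IsSquare x
square-neg {x} = mk⇔ to from
  where
  to : IsSquare (- x) → IsSquare x
  to (b , b≢0 , inj₁ -x≡b²) = b , b≢0 , inj₂ (trans (sym (ℤP.neg-involutive x)) (cong -_ -x≡b²))
  to (b , b≢0 , inj₂ -x≡-b²) = b , b≢0 , inj₁ (ℤP.neg-injective -x≡-b²)
  from : IsSquare x → IsSquare (- x)
  from (b , b≢0 , inj₁ x≡b²) = b , b≢0 , inj₂ (cong -_ x≡b²)
  from (b , b≢0 , inj₂ x≡-b²) = b , b≢0 , inj₁ (trans (cong -_ x≡-b²) (ℤP.neg-involutive (b ^ 2)))

neg-cube : ∀ b → - (b ^ 3) ≡ (- b) ^ 3
neg-cube = solve 1 (λ b → :- (b :^ 3) := (:- b) :^ 3) refl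

cube-scale : ∀ {x w} → w ≢ + 0 → IsCube (x * w ^ 3) ⇔ IsCube x
cube-scale {x} {w} w≢0 = mk⇔ to from
  where
  root-is-cube : (∃ λ q → + q ≢ + 0 × (x ≡ (+ q) ^ 3 ⊎ x ≡ - ((+ q) ^ 3))) → IsCube x
  root-is-cube (q , q≢0 , inj₁ x≡q³) = + q , q≢0 , x≡q³
  root-is-cube (q , q≢0 , inj₂ x≡-q³) = - (+ q) , neg-nonzero q≢0 , trans x≡-q³ (neg-cube (+ q))
  to : IsCube (x * w ^ 3) → IsCube x
  to (c , c≢0 , xw³≡c³) = root-is-cube (signed-power 2 x w c w≢0 c≢0 (cong ∣_∣ xw³≡c³))
  from : IsCube x → IsCube (x * w ^ 3)
  from (b , b≢0 , x≡b³) = b * w , *-nonzero b≢0 w≢0 , trans (cong (_* w ^ 3) x≡b³) (product-cube b w)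
    where
    product-cube : ∀ b w → b ^ 3 * w ^ 3 ≡ (b * w) ^ 3
    product-cube = solve 2 (λ b w → b :^ 3 :* w :^ 3 := (b :* w) :^ 3) refl

cube-neg : ∀ {x} → IsCube (- x) ⇔ IsCube x
cube-neg {x} = mk⇔ to from
  where
  to : IsCube (- x) → IsCube x
  to (b , b≢0 , -x≡b³) =
    - b , neg-nonzero b≢0 , trans (sym (ℤP.neg-involutive x)) (trans (cong -_ -x≡b³) (neg-cube b))
  from : IsCube x → IsCube (- x)
  from (b , b≢0 , x≡b³) = - b , neg-nonzero b≢0 , trans (cong -_ x≡b³) (neg-cube b)

-- x² is a cube iff x is: x·c³ = x³ when x² = c³, so `cube-scale` applies.
cube-of-square : ∀ {x} → x ≢ + 0 → IsCube (x ^ 2) ⇔ IsCube x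
cube-of-square {x} x≢0 = mk⇔ to from
  where
  to : IsCube (x ^ 2) → IsCube x
  to (c , c≢0 , x²≡c³) = Equivalence.to (cube-scale c≢0) (x , x≢0 , (begin
    x * c ^ 3 ≡⟨ cong (x *_) x²≡c³ ⟨
    x * x ^ 2 ≡⟨ solve 1 (λ x → x :* x :^ 2 := x :^ 3) refl x ⟩
    x ^ 3     ∎))
    where open ≡-Reasoning
  from : IsCube x → IsCube (x ^ 2)
  from (b , b≢0 , x≡b³) = b ^ 2 , ^-nonzero 2 b≢0 ,
    trans (cong (_^ 2) x≡b³) (solve 1 (λ b → (b :^ 3) :^ 2 := (b :^ 2) :^ 3) refl b)

-- The units ±1 of ℤ; declared as instances so that concrete signs are found automatically.
data Unit : ℤ → Set where
  instance
    unit₊ : Unit (+ 1)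
    unit₋ : Unit -[1+ 0 ]

unit-square : ∀ {s y} → {{Unit s}} → IsSquare (s * y) ⇔ IsSquare y
unit-square {y = y} {{unit₊}} = ≡⇒⇔ IsSquare (ℤP.*-identityˡ y)
unit-square {y = y} {{unit₋}} = ⇔-trans (≡⇒⇔ IsSquare (ℤP.-1*i≡-i y)) square-neg

unit-cube : ∀ {s y} → {{Unit s}} → IsCube (s * y) ⇔ IsCube y
unit-cube {y = y} {{unit₊}} = ≡⇒⇔ IsCube (ℤP.*-identityˡ y)
unit-cube {y = y} {{unit₋}} = ⇔-trans (≡⇒⇔ IsCube (ℤP.-1*i≡-i y)) cube-neg

*-distribʳ-− : ∀ x y z → (x - y) * z ≡ x * z - y * z
*-distribʳ-− = solve 3 (λ x y z → (x :- y) :* z := x :* z :- y :* z) refl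

*-distribˡ-− : ∀ x y z → x * (y - z) ≡ x * y - x * z
*-distribˡ-− = solve 3 (λ x y z → x :* (y :- z) := x :* y :- x :* z) refl

-- Right-hand sides of the defining recurrences of an elliptic divisibility sequence C:
-- C(2m+1) = odd-rhs C m, and C(2m)·C(2) = even-rhs C m.
odd-rhs : (ℕ → ℤ) → ℕ → ℤ
odd-rhs C m = C (m ℕ.+ 2) * C m ^ 3 - C (m ℕ.∸ 1) * C (m ℕ.+ 1) ^ 3

even-rhs : (ℕ → ℤ) → ℕ → ℤ
even-rhs C m = C m * (C (m ℕ.+ 2) * C (m ℕ.∸ 1) ^ 2 - C (m ℕ.∸ 2) * C (m ℕ.+ 1) ^ 2)

power-split : ∀ γ {p q m} k → p ℕ.+ q ℕ.* k ≡ m → γ ^ m ≡ γ ^ p * (γ ^ q) ^ k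
power-split γ {p} {q} {m} k p+qk≡m = begin
  γ ^ m                 ≡⟨ cong (γ ^_) p+qk≡m ⟨
  γ ^ (p ℕ.+ q ℕ.* k)   ≡⟨ ℤP.^-distribˡ-+-* γ p (q ℕ.* k) ⟩
  γ ^ p * γ ^ (q ℕ.* k) ≡⟨ cong (γ ^ p *_) (ℤP.^-*-assoc γ q k) ⟨
  γ ^ p * (γ ^ q) ^ k   ∎
  where open ≡-Reasoning

weighted-cube : ∀ γ Y Z {p q m} → p ℕ.+ q ℕ.* 3 ≡ m → Y * Z ^ 3 * γ ^ m ≡ (Y * γ ^ p) * (Z * γ ^ q) ^ 3
weighted-cube γ Y Z {p} {q} eq = trans (cong (Y * Z ^ 3 *_) (power-split γ {p} {q} 3 eq))
  (solve 4 (λ Y Z u v → Y :* Z :^ 3 :* (u :* v :^ 3) := (Y :* u) :* (Z :* v) :^ 3) refl Y Z (γ ^ p) (γ ^ q))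

weighted-square : ∀ γ Y Z {p q m} → p ℕ.+ q ℕ.* 2 ≡ m → Y * Z ^ 2 * γ ^ m ≡ (Y * γ ^ p) * (Z * γ ^ q) ^ 2
weighted-square γ Y Z {p} {q} eq = trans (cong (Y * Z ^ 2 *_) (power-split γ {p} {q} 2 eq))
  (solve 4 (λ Y Z u v → Y :* Z :^ 2 :* (u :* v :^ 2) := (Y :* u) :* (Z :* v) :^ 2) refl Y Z (γ ^ p) (γ ^ q))

-- The odd recurrence survives rescaling every term C(i) by a power γ^(w i), provided the
-- weights are balanced: w(m+2) + 3w(m) = w(m-1) + 3w(m+1) = the weight of the left side.
twist-odd : ∀ γ {X Y Z U V p q r t m} → p ℕ.+ q ℕ.* 3 ≡ m → r ℕ.+ t ℕ.* 3 ≡ m →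
  X ≡ Y * Z ^ 3 - U * V ^ 3 →
  X * γ ^ m ≡ (Y * γ ^ p) * (Z * γ ^ q) ^ 3 - (U * γ ^ r) * (V * γ ^ t) ^ 3
twist-odd γ {X} {Y} {Z} {U} {V} {p} {q} {r} {t} {m} eq₁ eq₂ X≡ = begin
  X * γ ^ m                                ≡⟨ cong (_* γ ^ m) X≡ ⟩
  (Y * Z ^ 3 - U * V ^ 3) * γ ^ m          ≡⟨ *-distribʳ-− (Y * Z ^ 3) (U * V ^ 3) (γ ^ m) ⟩
  Y * Z ^ 3 * γ ^ m - U * V ^ 3 * γ ^ m    ≡⟨ cong₂ _-_ (weighted-cube γ Y Z {p} {q} eq₁) (weighted-cube γ U V {r} {t} eq₂) ⟩
  (Y * γ ^ p) * (Z * γ ^ q) ^ 3 - (U * γ ^ r) * (V * γ ^ t) ^ 3 ∎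
  where open ≡-Reasoning

twist-even : ∀ γ H {X Y Z U V W p q r s t w m} → q ℕ.+ r ℕ.* 2 ≡ w → s ℕ.+ t ℕ.* 2 ≡ w → p ℕ.+ w ≡ m →
  X * (Y * Z ^ 2 - U * V ^ 2) ≡ W * H →
  (X * γ ^ p) * ((Y * γ ^ q) * (Z * γ ^ r) ^ 2 - (U * γ ^ s) * (V * γ ^ t) ^ 2) ≡ (W * γ ^ m) * H
twist-even γ H {X} {Y} {Z} {U} {V} {W} {p} {q} {r} {s} {t} {w} {m} eq₁ eq₂ eq₃ X[]≡WH = begin
  (X * γ ^ p) * ((Y * γ ^ q) * (Z * γ ^ r) ^ 2 - (U * γ ^ s) * (V * γ ^ t) ^ 2)
    ≡⟨ cong ((X * γ ^ p) *_) (cong₂ _-_ (weighted-square γ Y Z {q} {r} eq₁) (weighted-square γ U V {s} {t} eq₂)) ⟨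
  (X * γ ^ p) * (Y * Z ^ 2 * γ ^ w - U * V ^ 2 * γ ^ w)
    ≡⟨ solve 7 (λ X u Y Z U V v → (X :* u) :* (Y :* Z :^ 2 :* v :- U :* V :^ 2 :* v)
                                 := (X :* (Y :* Z :^ 2 :- U :* V :^ 2)) :* (u :* v))
         refl X (γ ^ p) Y Z U V (γ ^ w) ⟩
  (X * (Y * Z ^ 2 - U * V ^ 2)) * (γ ^ p * γ ^ w)
    ≡⟨ cong₂ _*_ X[]≡WH (trans (sym (ℤP.^-distribˡ-+-* γ p w)) (cong (γ ^_) eq₃)) ⟩
  W * H * γ ^ m
    ≡⟨ solve 3 (λ W H g → W :* H :* g := (W :* g) :* H) refl W H (γ ^ m) ⟩
  (W * γ ^ m) * H ∎
  where open ≡-Reasoning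

≤m+2 : ∀ m k → m ℕ.∸ k ≤ m ℕ.+ 2
≤m+2 m k = ℕP.≤-trans (ℕP.m∸n≤m m k) (ℕP.m≤m+n m 2)

odd-rhs-cong : ∀ {C D} m → (∀ i → i ≤ m ℕ.+ 2 → C i ≡ D i) → odd-rhs C m ≡ odd-rhs D m
odd-rhs-cong m C≡D =
  cong₂ _-_ (cong₂ (λ y z → y * z ^ 3) (C≡D (m ℕ.+ 2) ℕP.≤-refl) (C≡D m (≤m+2 m 0)))
            (cong₂ (λ y z → y * z ^ 3) (C≡D (m ℕ.∸ 1) (≤m+2 m 1)) (C≡D (m ℕ.+ 1) (ℕP.+-monoʳ-≤ m (s≤s z≤n))))

even-rhs-cong : ∀ {C D} m → (∀ i → i ≤ m ℕ.+ 2 → C i ≡ D i) → even-rhs C m ≡ even-rhs D m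
even-rhs-cong m C≡D = cong₂ _*_ (C≡D m (≤m+2 m 0))
  (cong₂ _-_ (cong₂ (λ y z → y * z ^ 2) (C≡D (m ℕ.+ 2) ℕP.≤-refl) (C≡D (m ℕ.∸ 1) (≤m+2 m 1)))
             (cong₂ (λ y z → y * z ^ 2) (C≡D (m ℕ.∸ 2) (≤m+2 m 2)) (C≡D (m ℕ.+ 1) (ℕP.+-monoʳ-≤ m (s≤s z≤n)))))

below-fuel : ∀ {i b n f} → i ≤ b → b < n → n ≤ f → i < f
below-fuel i≤b b<n n≤f = ℕP.≤-trans (s≤s i≤b) (ℕP.≤-trans b<n n≤f)

-- Arithmetic behind the fact that one recursion step at index 5 + (j + j), resp. 6 + (j + j),
-- only reads indices below it (up to j + 4, resp. j + 5).
step-bound : ∀ j → j ℕ.+ 2 ≤ 2 ℕ.+ (j ℕ.+ j)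
step-bound j = ℕP.≤-trans (ℕP.≤-reflexive (ℕP.+-comm j 2)) (ℕP.+-monoʳ-≤ 2 (ℕP.m≤m+n j j))

hF-odd : ∀ α f k → (5 ℕ.+ k) % 2 ≡ 1 → hF α (suc f) (5 ℕ.+ k) ≡ odd-rhs (hF α f) ⌊ 5 ℕ.+ k /2⌋
hF-odd α f k odd with (5 ℕ.+ k) % 2 | odd
... | .1 | refl = refl

hF-even : ∀ α f k → (5 ℕ.+ k) % 2 ≡ 0 → hF α (suc f) (5 ℕ.+ k) ≡ even-rhs (hF α f) ⌊ 5 ℕ.+ k /2⌋ ÷ h2 α
hF-even α f k even with (5 ℕ.+ k) % 2 | even
... | .0 | refl = refl

parity : ∀ k → ∃ λ j → k ≡ j ℕ.+ j ⊎ k ≡ suc (j ℕ.+ j)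
parity zero = 0 , inj₁ refl
parity (suc k) with parity k
... | j , inj₁ k≡2j = j , inj₂ (cong suc k≡2j)
... | j , inj₂ k≡2j+1 = suc j , inj₁ (cong suc (trans k≡2j+1 (sym (ℕP.+-suc j j))))

half-even : ∀ j → ⌊ j ℕ.+ j /2⌋ ≡ j
half-even zero = refl
half-even (suc j) = trans (cong (λ x → ⌊ suc x /2⌋) (ℕP.+-suc j j)) (cong suc (half-even j))

half-odd : ∀ j → ⌊ suc (j ℕ.+ j) /2⌋ ≡ j
half-odd zero = refl
half-odd (suc j) = trans (cong (λ x → ⌊ suc (suc x) /2⌋) (ℕP.+-suc j j)) (cong suc (half-odd j))

%2-+double : ∀ r j → (r ℕ.+ (j ℕ.+ j)) % 2 ≡ r % 2
%2-+double r j = trans (cong (_% 2) (double r j)) (ℕD.[m+kn]%n≡m%n r j 2)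
  where
  double : ∀ r j → r ℕ.+ (j ℕ.+ j) ≡ r ℕ.+ j ℕ.* 2
  double = ℕ-solve

exact-/ℕ : ∀ y k → (y * + suc k) /ℕ suc k ≡ y
exact-/ℕ (+ n) k = trans (cong (_/ℕ suc k) (sym (ℤP.pos-* n (suc k)))) (cong +_ (ℕD.m*n/n≡m n (suc k)))
exact-/ℕ -[1+ n ] k with suc (k ℕ.+ n ℕ.* suc k) % suc k | ℕD.m*n%n≡0 (suc n) (suc k)
... | .0 | refl = cong (λ z → - (+ z)) (ℕD.m*n/n≡m (suc n) (suc k))

exact-÷ : ∀ x d → d ≢ + 0 → (x * d) ÷ d ≡ x
exact-÷ x (+ zero) d≢0 = ⊥-elim (d≢0 refl)
exact-÷ x (+ suc k) _ = trans (ℤDM.div-pos-is-/ℕ (x * + suc k) (suc k)) (exact-/ℕ x k)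
exact-÷ x -[1+ k ] _ = trans (ℤDM.div-neg-is-neg-/ℕ (x * -[1+ k ]) (suc k)) (begin
  - ((x * -[1+ k ]) /ℕ suc k)     ≡⟨ cong (λ y → - (y /ℕ suc k)) (trans (sym (ℤP.neg-distribʳ-* x (+ suc k)))
                                                                        (ℤP.neg-distribˡ-* x (+ suc k))) ⟩
  - (((- x) * + suc k) /ℕ suc k)  ≡⟨ cong -_ (exact-/ℕ (- x) k) ⟩
  - - x                           ≡⟨ ℤP.neg-involutive x ⟩
  x                               ∎)
  where open ≡-Reasoning

quasi-periodic : ∀ (e : ℕ → ℕ) c → (∀ n → e (7 ℕ.+ n) ≡ e n ℕ.+ (2 ℕ.* n ℕ.+ 7) ℕ.* c) →
  ∀ N t → e (N ℕ.* 7 ℕ.+ t) ≡ e t ℕ.+ N ℕ.* (2 ℕ.* t ℕ.+ N ℕ.* 7) ℕ.* c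
quasi-periodic e c step zero t = sym (ℕP.+-identityʳ (e t))
quasi-periodic e c step (suc N) t = begin
  e (7 ℕ.+ (N ℕ.* 7 ℕ.+ t))                                      ≡⟨ step (N ℕ.* 7 ℕ.+ t) ⟩
  e (N ℕ.* 7 ℕ.+ t) ℕ.+ (2 ℕ.* (N ℕ.* 7 ℕ.+ t) ℕ.+ 7) ℕ.* c      ≡⟨ cong (ℕ._+ (2 ℕ.* (N ℕ.* 7 ℕ.+ t) ℕ.+ 7) ℕ.* c)
                                                                       (quasi-periodic e c step N t) ⟩
  e t ℕ.+ N ℕ.* (2 ℕ.* t ℕ.+ N ℕ.* 7) ℕ.* c ℕ.+ (2 ℕ.* (N ℕ.* 7 ℕ.+ t) ℕ.+ 7) ℕ.* c
                                                                  ≡⟨ accumulate (e t) c N t ⟩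
  e t ℕ.+ suc N ℕ.* (2 ℕ.* t ℕ.+ suc N ℕ.* 7) ℕ.* c              ∎
  where
  open ≡-Reasoning
  accumulate : ∀ a c N t → a ℕ.+ N ℕ.* (2 ℕ.* t ℕ.+ N ℕ.* 7) ℕ.* c ℕ.+ (2 ℕ.* (N ℕ.* 7 ℕ.+ t) ℕ.+ 7) ℕ.* c
                           ≡ a ℕ.+ suc N ℕ.* (2 ℕ.* t ℕ.+ suc N ℕ.* 7) ℕ.* c
  accumulate = ℕ-solve

-- Hence on the residue class of s modulo 7K, e(n) ≡ e(s) modulo K, with explicit quotient.
exponent-residue : ∀ (e : ℕ → ℕ) c → (∀ n → e (7 ℕ.+ n) ≡ e n ℕ.+ (2 ℕ.* n ℕ.+ 7) ℕ.* c) →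
  ∀ K .{{_ : NonZero K}} Q s →
  e (Q ℕ.* K ℕ.* 7 ℕ.+ s) ≡ e s % K ℕ.+ K ℕ.* (e s ℕ./ K ℕ.+ Q ℕ.* (2 ℕ.* s ℕ.+ Q ℕ.* K ℕ.* 7) ℕ.* c)
exponent-residue e c step K Q s = begin
  e (Q ℕ.* K ℕ.* 7 ℕ.+ s)                                         ≡⟨ quasi-periodic e c step (Q ℕ.* K) s ⟩
  e s ℕ.+ Q ℕ.* K ℕ.* (2 ℕ.* s ℕ.+ Q ℕ.* K ℕ.* 7) ℕ.* c            ≡⟨ cong (ℕ._+ _) (ℕD.m≡m%n+[m/n]*n (e s) K) ⟩
  e s % K ℕ.+ e s ℕ./ K ℕ.* K ℕ.+ Q ℕ.* K ℕ.* (2 ℕ.* s ℕ.+ Q ℕ.* K ℕ.* 7) ℕ.* c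
                                                                   ≡⟨ regroup (e s % K) (e s ℕ./ K) K Q s c ⟩
  e s % K ℕ.+ K ℕ.* (e s ℕ./ K ℕ.+ Q ℕ.* (2 ℕ.* s ℕ.+ Q ℕ.* K ℕ.* 7) ℕ.* c) ∎
  where
  open ≡-Reasoning
  regroup : ∀ r q K Q s c → r ℕ.+ q ℕ.* K ℕ.+ Q ℕ.* K ℕ.* (2 ℕ.* s ℕ.+ Q ℕ.* K ℕ.* 7) ℕ.* c
                            ≡ r ℕ.+ K ℕ.* (q ℕ.+ Q ℕ.* (2 ℕ.* s ℕ.+ Q ℕ.* K ℕ.* 7) ℕ.* c)
  regroup = ℕ-solve

module ClosedForm (α : ℤ) where

  -- Signed monomials s·α^a·(α-1)^b. The definition is opaque so that monomials are
  -- manipulated only through the lemmas below, and unify by their exponents.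
  opaque
    mono : ℤ → ℕ → ℕ → ℤ
    mono s a b = s * (α ^ a * (α - + 1) ^ b)

    mono-mul : ∀ {s a b t c d} → mono s a b * mono t c d ≡ mono (s * t) (a ℕ.+ c) (b ℕ.+ d)
    mono-mul {s} {a} {b} {t} {c} {d}
      rewrite ℤP.^-distribˡ-+-* α a c | ℤP.^-distribˡ-+-* (α - + 1) b d =
      solve 6 (λ s t x y z w → (s :* (x :* y)) :* (t :* (z :* w)) := (s :* t) :* ((x :* z) :* (y :* w)))
        refl s t (α ^ a) ((α - + 1) ^ b) (α ^ c) ((α - + 1) ^ d)

    mono-coefficient : ∀ {s a b} → mono s a b ≡ s * mono (+ 1) a b
    mono-coefficient {s} {a} {b} = cong (s *_) (sym (ℤP.*-identityˡ (α ^ a * (α - + 1) ^ b)))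

    mono-unit : mono (+ 1) 0 0 ≡ + 1
    mono-unit = refl

    mono-zero : ∀ {a b} → mono (+ 0) a b ≡ + 0
    mono-zero = refl

    mono-neg : ∀ {s a b} → mono (- s) a b ≡ - mono s a b
    mono-neg {s} {a} {b} = sym (ℤP.neg-distribˡ-* s (α ^ a * (α - + 1) ^ b))

    β-split : ∀ {s a b} → mono s a (suc b) ≡ mono s (suc a) b - mono s a b
    β-split {s} {a} {b} = solve 4 (λ s x y a → s :* (x :* ((a :- con (+ 1)) :* y))
      := s :* ((a :* x) :* y) :- s :* (x :* y)) refl s (α ^ a) ((α - + 1) ^ b) α

    mono-α : mono (+ 1) 1 0 ≡ α
    mono-α = solve 1 (λ a → con (+ 1) :* (a :^ 1 :* (a :- con (+ 1)) :^ 0) := a) refl α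

    mono-α² : mono (+ 1) 2 0 ≡ α ^ 2
    mono-α² = solve 1 (λ a → con (+ 1) :* (a :^ 2 :* (a :- con (+ 1)) :^ 0) := a :^ 2) refl α

    mono-β : mono (+ 1) 0 1 ≡ α - + 1
    mono-β = solve 1 (λ a → con (+ 1) :* (a :^ 0 :* (a :- con (+ 1)) :^ 1) := a :- con (+ 1)) refl α

    h2-mono : h2 α ≡ mono -[1+ 0 ] 2 1
    h2-mono = sym (trans (ℤP.-1*i≡-i _) (cong (λ x → - (α ^ 2 * x)) (ℤP.^-identityʳ (α - + 1))))

    h3-mono : h3 α ≡ mono -[1+ 0 ] 6 3
    h3-mono = sym (ℤP.-1*i≡-i (α ^ 6 * (α - + 1) ^ 3))

    h4-mono : h4 α ≡ mono (+ 1) 11 6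
    h4-mono = sym (ℤP.*-identityˡ (h4 α))

    mono-nonzero : ∀ {s a b} → α ≢ + 0 → α ≢ + 1 → s ≢ + 0 → mono s a b ≢ + 0
    mono-nonzero {s} {a} {b} α≢0 α≢1 s≢0 =
      *-nonzero s≢0 (*-nonzero (^-nonzero a α≢0) (^-nonzero b β≢0))
      where
      β≢0 : α - + 1 ≢ + 0
      β≢0 β≡0 = α≢1 (begin
        α               ≡⟨ solve 1 (λ a → a := (a :- con (+ 1)) :+ con (+ 1)) refl α ⟩
        (α - + 1) + + 1 ≡⟨ cong (_+ + 1) β≡0 ⟩
        + 1             ∎)
        where open ≡-Reasoning

  mono-pow : ∀ {s a b} k → mono s a b ^ k ≡ mono (s ^ k) (k ℕ.* a) (k ℕ.* b)
  mono-pow zero = sym mono-unit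
  mono-pow {s} {a} {b} (suc k) =
    trans (cong (mono s a b *_) (mono-pow k)) (mono-mul {s} {a} {b} {s ^ k} {k ℕ.* a} {k ℕ.* b})

  mono-scale : ∀ {s a b} c d → mono s (a ℕ.+ c) (b ℕ.+ d) ≡ mono s a b * mono (+ 1) c d
  mono-scale {s} {a} {b} c d =
    sym (trans (mono-mul {s} {a} {b} {+ 1} {c} {d}) (cong (λ t → mono t (a ℕ.+ c) (b ℕ.+ d)) (ℤP.*-identityʳ s)))

  mono-split : ∀ {s a b} k c d → mono s (a ℕ.+ k ℕ.* c) (b ℕ.+ k ℕ.* d) ≡ mono s a b * mono (+ 1) c d ^ k
  mono-split {s} {a} {b} k c d = begin
    mono s (a ℕ.+ k ℕ.* c) (b ℕ.+ k ℕ.* d) ≡⟨ mono-scale (k ℕ.* c) (k ℕ.* d) ⟩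
    mono s a b * mono (+ 1) (k ℕ.* c) (k ℕ.* d)   ≡⟨ cong (λ t → mono s a b * mono t (k ℕ.* c) (k ℕ.* d)) (ℤP.^-zeroˡ k) ⟨
    mono s a b * mono ((+ 1) ^ k) (k ℕ.* c) (k ℕ.* d) ≡⟨ cong (mono s a b *_) (mono-pow k) ⟨
    mono s a b * mono (+ 1) c d ^ k ∎
    where open ≡-Reasoning

  mono-cube-product : ∀ {s a b t c d} →
    mono s a b * mono t c d ^ 3 ≡ mono (s * t ^ 3) (a ℕ.+ 3 ℕ.* c) (b ℕ.+ 3 ℕ.* d)
  mono-cube-product {s} {a} {b} {t} {c} {d} =
    trans (cong (mono s a b *_) (mono-pow 3)) (mono-mul {s} {a} {b} {t ^ 3} {3 ℕ.* c} {3 ℕ.* d})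

  mono-square-product : ∀ {s a b t c d} →
    mono s a b * mono t c d ^ 2 ≡ mono (s * t ^ 2) (a ℕ.+ 2 ℕ.* c) (b ℕ.+ 2 ℕ.* d)
  mono-square-product {s} {a} {b} {t} {c} {d} =
    trans (cong (mono s a b *_) (mono-pow 2)) (mono-mul {s} {a} {b} {t ^ 2} {2 ℕ.* c} {2 ℕ.* d})

  expand-odd : ∀ {s a b t c d u e f v g i} →
    mono s a b * mono t c d ^ 3 - mono u e f * mono v g i ^ 3
      ≡ mono (s * t ^ 3) (a ℕ.+ 3 ℕ.* c) (b ℕ.+ 3 ℕ.* d) - mono (u * v ^ 3) (e ℕ.+ 3 ℕ.* g) (f ℕ.+ 3 ℕ.* i)
  expand-odd {s} {a} {b} {t} {c} {d} {u} {e} {f} {v} {g} {i} =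
    cong₂ _-_ (mono-cube-product {s} {a} {b} {t} {c} {d}) (mono-cube-product {u} {e} {f} {v} {g} {i})

  expand-even : ∀ {s a b t c d u e f v g i x k l} →
    mono s a b * (mono t c d * mono u e f ^ 2 - mono v g i * mono x k l ^ 2)
      ≡ mono (s * (t * u ^ 2)) (a ℕ.+ (c ℕ.+ 2 ℕ.* e)) (b ℕ.+ (d ℕ.+ 2 ℕ.* f))
        - mono (s * (v * x ^ 2)) (a ℕ.+ (g ℕ.+ 2 ℕ.* k)) (b ℕ.+ (i ℕ.+ 2 ℕ.* l))
  expand-even {s} {a} {b} {t} {c} {d} {u} {e} {f} {v} {g} {i} {x} {k} {l} = begin
    mono s a b * (mono t c d * mono u e f ^ 2 - mono v g i * mono x k l ^ 2)
      ≡⟨ cong (mono s a b *_) (cong₂ _-_ (mono-square-product {t} {c} {d} {u} {e} {f})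
                                          (mono-square-product {v} {g} {i} {x} {k} {l})) ⟩
    mono s a b * (mono (t * u ^ 2) (c ℕ.+ 2 ℕ.* e) (d ℕ.+ 2 ℕ.* f) - mono (v * x ^ 2) (g ℕ.+ 2 ℕ.* k) (i ℕ.+ 2 ℕ.* l))
      ≡⟨ *-distribˡ-− (mono s a b) _ _ ⟩
    mono s a b * mono (t * u ^ 2) (c ℕ.+ 2 ℕ.* e) (d ℕ.+ 2 ℕ.* f) - mono s a b * mono (v * x ^ 2) (g ℕ.+ 2 ℕ.* k) (i ℕ.+ 2 ℕ.* l)
      ≡⟨ cong₂ _-_ (mono-mul {s} {a} {b} {t * u ^ 2} {c ℕ.+ 2 ℕ.* e} {d ℕ.+ 2 ℕ.* f})
                   (mono-mul {s} {a} {b} {v * x ^ 2} {g ℕ.+ 2 ℕ.* k} {i ℕ.+ 2 ℕ.* l}) ⟩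
    mono (s * (t * u ^ 2)) (a ℕ.+ (c ℕ.+ 2 ℕ.* e)) (b ℕ.+ (d ℕ.+ 2 ℕ.* f))
      - mono (s * (v * x ^ 2)) (a ℕ.+ (g ℕ.+ 2 ℕ.* k)) (b ℕ.+ (i ℕ.+ 2 ℕ.* l)) ∎
    where open ≡-Reasoning

  -- The identities between three monomials that close the base cases of the recurrences:
  -- β-split, its negation β-split′, and three identities in which a term has coefficient 0.
  β-split′ : ∀ {s a b} → mono s a (suc b) ≡ mono (- s) a b - mono (- s) (suc a) b
  β-split′ {s} {a} {b} = begin
    mono s a (suc b)                     ≡⟨ β-split ⟩
    mono s (suc a) b - mono s a b        ≡⟨ solve 2 (λ x y → x :- y := (:- y) :- (:- x)) refl (mono s (suc a) b) (mono s a b) ⟩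
    - mono s a b - - mono s (suc a) b    ≡⟨ cong₂ _-_ mono-neg mono-neg ⟨
    mono (- s) a b - mono (- s) (suc a) b ∎
    where open ≡-Reasoning

  zero-minus-equal : ∀ {a b s c d} → mono (+ 0) a b ≡ mono s c d - mono s c d
  zero-minus-equal {s = s} {c} {d} = trans mono-zero (sym (ℤP.+-inverseʳ (mono s c d)))

  minus-zero : ∀ {s a b c d} → mono s a b ≡ mono s a b - mono (+ 0) c d
  minus-zero {s} {a} {b} = sym (trans (cong (λ z → mono s a b - z) mono-zero) (ℤP.+-identityʳ (mono s a b)))

  zero-minus : ∀ {s a b c d} → mono s a b ≡ mono (+ 0) c d - mono (- s) a b
  zero-minus {s} {a} {b} {c} {d} = sym (begin
    mono (+ 0) c d - mono (- s) a b ≡⟨ cong₂ _-_ mono-zero mono-neg ⟩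
    + 0 - - mono s a b              ≡⟨ solve 1 (λ x → con (+ 0) :- (:- x) := x) refl (mono s a b) ⟩
    mono s a b                      ∎)
    where open ≡-Reasoning

  -- The closed form h_n = sgn(n)·α^eα(n)·(α-1)^eβ(n). The sign has period 7 (h_7 = 0, the
  -- point (0,0) having order 7), and passing from n to n+7 multiplies by γ^(2n+7),
  -- where γ = α⁵(α-1)³.
  sgn : ℕ → ℤ
  sgn 0 = + 0
  sgn 1 = + 1
  sgn 2 = -[1+ 0 ]
  sgn 3 = -[1+ 0 ]
  sgn 4 = + 1
  sgn 5 = + 1
  sgn 6 = -[1+ 0 ]
  sgn (suc (suc (suc (suc (suc (suc (suc n))))))) = sgn n

  eα : ℕ → ℕ
  eα 0 = 0
  eα 1 = 0
  eα 2 = 2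
  eα 3 = 6
  eα 4 = 11
  eα 5 = 17
  eα 6 = 25
  eα (suc (suc (suc (suc (suc (suc (suc n))))))) = eα n ℕ.+ (2 ℕ.* n ℕ.+ 7) ℕ.* 5

  eβ : ℕ → ℕ
  eβ 0 = 0
  eβ 1 = 0
  eβ 2 = 1
  eβ 3 = 3
  eβ 4 = 6
  eβ 5 = 10
  eβ 6 = 15
  eβ (suc (suc (suc (suc (suc (suc (suc n))))))) = eβ n ℕ.+ (2 ℕ.* n ℕ.+ 7) ℕ.* 3

  closed : ℕ → ℤ
  closed n = mono (sgn n) (eα n) (eβ n)

  γ : ℤ
  γ = mono (+ 1) 5 3

  closed-shift : ∀ n → closed (7 ℕ.+ n) ≡ closed n * γ ^ (2 ℕ.* n ℕ.+ 7)
  closed-shift n = mono-split (2 ℕ.* n ℕ.+ 7) 5 3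

  closed-shift² : ∀ n → closed (7 ℕ.+ (7 ℕ.+ n)) ≡ closed n * γ ^ ((2 ℕ.* n ℕ.+ 7) ℕ.+ (2 ℕ.* (7 ℕ.+ n) ℕ.+ 7))
  closed-shift² n = begin
    closed (7 ℕ.+ (7 ℕ.+ n))                             ≡⟨ closed-shift (7 ℕ.+ n) ⟩
    closed (7 ℕ.+ n) * γ ^ w′                            ≡⟨ cong (_* γ ^ w′) (closed-shift n) ⟩
    closed n * γ ^ w * γ ^ w′                            ≡⟨ ℤP.*-assoc (closed n) (γ ^ w) (γ ^ w′) ⟩
    closed n * (γ ^ w * γ ^ w′)                          ≡⟨ cong (closed n *_) (ℤP.^-distribˡ-+-* γ w w′) ⟨
    closed n * γ ^ (w ℕ.+ w′)                            ∎
    where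
    open ≡-Reasoning
    w w′ : ℕ
    w = 2 ℕ.* n ℕ.+ 7
    w′ = 2 ℕ.* (7 ℕ.+ n) ℕ.+ 7

  lift-odd : ∀ j → closed (5 ℕ.+ (j ℕ.+ j)) ≡ odd-rhs closed (2 ℕ.+ j) →
             closed (5 ℕ.+ ((7 ℕ.+ j) ℕ.+ (7 ℕ.+ j))) ≡ odd-rhs closed (2 ℕ.+ (7 ℕ.+ j))
  lift-odd j rec = begin
    closed (5 ℕ.+ ((7 ℕ.+ j) ℕ.+ (7 ℕ.+ j)))  ≡⟨ cong closed (index j) ⟩
    closed (7 ℕ.+ (7 ℕ.+ n))                  ≡⟨ closed-shift² n ⟩
    closed n * γ ^ (w n ℕ.+ w (7 ℕ.+ n))
      ≡⟨ twist-odd γ {closed n} {closed (m ℕ.+ 2)} {closed m} {closed (m ℕ.∸ 1)} {closed (m ℕ.+ 1)}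
                     {w (m ℕ.+ 2)} {w m} {w (m ℕ.∸ 1)} {w (m ℕ.+ 1)} {w n ℕ.+ w (7 ℕ.+ n)}
                     (weights₁ j) (weights₂ j) rec ⟩
    (closed (m ℕ.+ 2) * γ ^ w (m ℕ.+ 2)) * (closed m * γ ^ w m) ^ 3
      - (closed (m ℕ.∸ 1) * γ ^ w (m ℕ.∸ 1)) * (closed (m ℕ.+ 1) * γ ^ w (m ℕ.+ 1)) ^ 3
      ≡⟨ cong₂ _-_ (cong₂ (λ y z → y * z ^ 3) (closed-shift (m ℕ.+ 2)) (closed-shift m))
                   (cong₂ (λ y z → y * z ^ 3) (closed-shift (m ℕ.∸ 1)) (closed-shift (m ℕ.+ 1))) ⟨
    odd-rhs closed (7 ℕ.+ m)                  ∎
    where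
    open ≡-Reasoning
    w : ℕ → ℕ
    w i = 2 ℕ.* i ℕ.+ 7
    n m : ℕ
    n = 5 ℕ.+ (j ℕ.+ j)
    m = 2 ℕ.+ j
    index : ∀ j → 5 ℕ.+ ((7 ℕ.+ j) ℕ.+ (7 ℕ.+ j)) ≡ 7 ℕ.+ (7 ℕ.+ (5 ℕ.+ (j ℕ.+ j)))
    index = ℕ-solve
    weights₁ : ∀ j → (2 ℕ.* ((2 ℕ.+ j) ℕ.+ 2) ℕ.+ 7) ℕ.+ (2 ℕ.* (2 ℕ.+ j) ℕ.+ 7) ℕ.* 3
                 ≡ (2 ℕ.* (5 ℕ.+ (j ℕ.+ j)) ℕ.+ 7) ℕ.+ (2 ℕ.* (7 ℕ.+ (5 ℕ.+ (j ℕ.+ j))) ℕ.+ 7)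
    weights₁ = ℕ-solve
    weights₂ : ∀ j → (2 ℕ.* (1 ℕ.+ j) ℕ.+ 7) ℕ.+ (2 ℕ.* ((2 ℕ.+ j) ℕ.+ 1) ℕ.+ 7) ℕ.* 3
                 ≡ (2 ℕ.* (5 ℕ.+ (j ℕ.+ j)) ℕ.+ 7) ℕ.+ (2 ℕ.* (7 ℕ.+ (5 ℕ.+ (j ℕ.+ j))) ℕ.+ 7)
    weights₂ = ℕ-solve

  lift-even : ∀ j → even-rhs closed (3 ℕ.+ j) ≡ closed (6 ℕ.+ (j ℕ.+ j)) * closed 2 →
              even-rhs closed (3 ℕ.+ (7 ℕ.+ j)) ≡ closed (6 ℕ.+ ((7 ℕ.+ j) ℕ.+ (7 ℕ.+ j))) * closed 2
  lift-even j rec = begin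
    even-rhs closed (7 ℕ.+ m)
      ≡⟨ cong₂ _*_ (closed-shift m)
           (cong₂ _-_ (cong₂ (λ y z → y * z ^ 2) (closed-shift (m ℕ.+ 2)) (closed-shift (m ℕ.∸ 1)))
                      (cong₂ (λ y z → y * z ^ 2) (closed-shift (m ℕ.∸ 2)) (closed-shift (m ℕ.+ 1)))) ⟩
    (closed m * γ ^ w m)
      * ((closed (m ℕ.+ 2) * γ ^ w (m ℕ.+ 2)) * (closed (m ℕ.∸ 1) * γ ^ w (m ℕ.∸ 1)) ^ 2
         - (closed (m ℕ.∸ 2) * γ ^ w (m ℕ.∸ 2)) * (closed (m ℕ.+ 1) * γ ^ w (m ℕ.+ 1)) ^ 2)
      ≡⟨ twist-even γ (closed 2) {closed m} {closed (m ℕ.+ 2)} {closed (m ℕ.∸ 1)} {closed (m ℕ.∸ 2)}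
                    {closed (m ℕ.+ 1)} {closed n} {w m} {w (m ℕ.+ 2)} {w (m ℕ.∸ 1)} {w (m ℕ.∸ 2)}
                    {w (m ℕ.+ 1)} {w (m ℕ.+ 2) ℕ.+ w (m ℕ.∸ 1) ℕ.* 2} {w n ℕ.+ w (7 ℕ.+ n)}
                    refl (weights₁ j) (weights₂ j) rec ⟩
    closed n * γ ^ (w n ℕ.+ w (7 ℕ.+ n)) * closed 2
      ≡⟨ cong (_* closed 2) (closed-shift² n) ⟨
    closed (7 ℕ.+ (7 ℕ.+ n)) * closed 2
      ≡⟨ cong (λ i → closed i * closed 2) (index j) ⟨
    closed (6 ℕ.+ ((7 ℕ.+ j) ℕ.+ (7 ℕ.+ j))) * closed 2 ∎
    where
    open ≡-Reasoning
    w : ℕ → ℕ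
    w i = 2 ℕ.* i ℕ.+ 7
    n m : ℕ
    n = 6 ℕ.+ (j ℕ.+ j)
    m = 3 ℕ.+ j
    index : ∀ j → 6 ℕ.+ ((7 ℕ.+ j) ℕ.+ (7 ℕ.+ j)) ≡ 7 ℕ.+ (7 ℕ.+ (6 ℕ.+ (j ℕ.+ j)))
    index = ℕ-solve
    weights₁ : ∀ j → (2 ℕ.* (1 ℕ.+ j) ℕ.+ 7) ℕ.+ (2 ℕ.* ((3 ℕ.+ j) ℕ.+ 1) ℕ.+ 7) ℕ.* 2
                 ≡ (2 ℕ.* ((3 ℕ.+ j) ℕ.+ 2) ℕ.+ 7) ℕ.+ (2 ℕ.* (2 ℕ.+ j) ℕ.+ 7) ℕ.* 2
    weights₁ = ℕ-solve
    weights₂ : ∀ j → (2 ℕ.* (3 ℕ.+ j) ℕ.+ 7)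
                       ℕ.+ ((2 ℕ.* ((3 ℕ.+ j) ℕ.+ 2) ℕ.+ 7) ℕ.+ (2 ℕ.* (2 ℕ.+ j) ℕ.+ 7) ℕ.* 2)
                 ≡ (2 ℕ.* (6 ℕ.+ (j ℕ.+ j)) ℕ.+ 7) ℕ.+ (2 ℕ.* (7 ℕ.+ (6 ℕ.+ (j ℕ.+ j))) ℕ.+ 7)
    weights₂ = ℕ-solve

  -- For j < 7 both sides are explicit monomials and one of the closing
  -- identities applies (j = 1 is h_7 = 0); larger j reduce to j - 7 by `lift-odd`.
  closed-odd : ∀ j → closed (5 ℕ.+ (j ℕ.+ j)) ≡ odd-rhs closed (2 ℕ.+ j)
  closed-odd 0 = trans β-split′ (sym expand-odd)
  closed-odd 1 = trans zero-minus-equal (sym expand-odd)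
  closed-odd 2 = trans β-split (sym expand-odd)
  closed-odd 3 = trans zero-minus (sym expand-odd)
  closed-odd 4 = trans minus-zero (sym expand-odd)
  closed-odd 5 = trans zero-minus (sym expand-odd)
  closed-odd 6 = trans minus-zero (sym expand-odd)
  closed-odd (suc (suc (suc (suc (suc (suc (suc j))))))) = lift-odd j (closed-odd j)

  closed-even : ∀ j → even-rhs closed (3 ℕ.+ j) ≡ closed (6 ℕ.+ (j ℕ.+ j)) * closed 2
  closed-even 0 = trans expand-even (sym (trans mono-mul β-split′))
  closed-even 1 = trans expand-even (sym (trans mono-mul β-split))
  closed-even 2 = trans expand-even (sym (trans mono-mul zero-minus))
  closed-even 3 = trans expand-even (sym (trans mono-mul minus-zero))
  closed-even 4 = trans expand-even (sym (trans mono-mul zero-minus-equal))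
  closed-even 5 = trans expand-even (sym (trans mono-mul zero-minus))
  closed-even 6 = trans expand-even (sym (trans mono-mul minus-zero))
  closed-even (suc (suc (suc (suc (suc (suc (suc j))))))) = lift-even j (closed-even j)

  sgn-periodic : ∀ N t → sgn (N ℕ.* 7 ℕ.+ t) ≡ sgn t
  sgn-periodic zero t = refl
  sgn-periodic (suc N) t = sgn-periodic N t

  residue-form : ∀ k n s → n % (suc k ℕ.* 7) ≡ s →
    ∃₂ λ c d → closed n ≡ sgn s * (mono (+ 1) (eα s % suc k) (eβ s % suc k) * mono (+ 1) c d ^ suc k)
  residue-form k n s n%≡s = cα , cβ , (begin
    closed n                                                        ≡⟨ cong closed n≡ ⟩
    mono (sgn (N ℕ.* 7 ℕ.+ s)) (eα (N ℕ.* 7 ℕ.+ s)) (eβ (N ℕ.* 7 ℕ.+ s))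
      ≡⟨ cong₂ (mono (sgn (N ℕ.* 7 ℕ.+ s))) (exponent-residue eα 5 (λ _ → refl) K Q s)
                                             (exponent-residue eβ 3 (λ _ → refl) K Q s) ⟩
    mono (sgn (N ℕ.* 7 ℕ.+ s)) (eα s % K ℕ.+ K ℕ.* cα) (eβ s % K ℕ.+ K ℕ.* cβ)
      ≡⟨ cong (λ σ → mono σ (eα s % K ℕ.+ K ℕ.* cα) (eβ s % K ℕ.+ K ℕ.* cβ)) (sgn-periodic N s) ⟩
    mono (sgn s) (eα s % K ℕ.+ K ℕ.* cα) (eβ s % K ℕ.+ K ℕ.* cβ)    ≡⟨ mono-split K cα cβ ⟩
    mono (sgn s) (eα s % K) (eβ s % K) * mono (+ 1) cα cβ ^ K       ≡⟨ cong (_* mono (+ 1) cα cβ ^ K) mono-coefficient ⟩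
    sgn s * mono (+ 1) (eα s % K) (eβ s % K) * mono (+ 1) cα cβ ^ K ≡⟨ ℤP.*-assoc (sgn s) _ _ ⟩
    sgn s * (mono (+ 1) (eα s % K) (eβ s % K) * mono (+ 1) cα cβ ^ K) ∎)
    where
    open ≡-Reasoning
    K Q N cα cβ : ℕ
    K = suc k
    Q = n ℕ./ (K ℕ.* 7)
    N = Q ℕ.* K
    cα = eα s ℕ./ K ℕ.+ Q ℕ.* (2 ℕ.* s ℕ.+ N ℕ.* 7) ℕ.* 5
    cβ = eβ s ℕ./ K ℕ.+ Q ℕ.* (2 ℕ.* s ℕ.+ N ℕ.* 7) ℕ.* 3
    reorder : ∀ s Q K → s ℕ.+ Q ℕ.* (K ℕ.* 7) ≡ Q ℕ.* K ℕ.* 7 ℕ.+ s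
    reorder = ℕ-solve
    n≡ : n ≡ N ℕ.* 7 ℕ.+ s
    n≡ = trans (ℕD.m≡m%n+[m/n]*n n (K ℕ.* 7)) (trans (cong (ℕ._+ Q ℕ.* (K ℕ.* 7)) n%≡s) (reorder s Q K))

module Criteria (α : ℤ) (α≢0 : α ≢ + 0) (α≢1 : α ≢ + 1) where
  open ClosedForm α

  h2≢0 : h2 α ≢ + 0
  h2≢0 h2≡0 = mono-nonzero α≢0 α≢1 (λ ()) (trans (sym h2-mono) h2≡0)

  agrees : ∀ f n → n < f → hF α f n ≡ closed n
  agrees (suc f) 0 _ = sym mono-zero
  agrees (suc f) 1 _ = sym mono-unit
  agrees (suc f) 2 _ = h2-mono
  agrees (suc f) 3 _ = h3-mono
  agrees (suc f) 4 _ = h4-mono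
  agrees (suc f) (suc (suc (suc (suc (suc k))))) (s≤s n≤f) with parity k
  ... | j , inj₁ refl = begin
    hF α (suc f) (5 ℕ.+ (j ℕ.+ j))            ≡⟨ hF-odd α f (j ℕ.+ j) (%2-+double 5 j) ⟩
    odd-rhs (hF α f) ⌊ 5 ℕ.+ (j ℕ.+ j) /2⌋    ≡⟨ cong (λ i → odd-rhs (hF α f) (2 ℕ.+ i)) (half-odd j) ⟩
    odd-rhs (hF α f) (2 ℕ.+ j)                ≡⟨ odd-rhs-cong (2 ℕ.+ j) (λ i i≤ → agrees f i
                                                   (below-fuel i≤ (ℕP.+-monoʳ-≤ 3 (step-bound j)) n≤f)) ⟩
    odd-rhs closed (2 ℕ.+ j)                  ≡⟨ closed-odd j ⟨
    closed (5 ℕ.+ (j ℕ.+ j))                  ∎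
    where open ≡-Reasoning
  ... | j , inj₂ refl = begin
    hF α (suc f) (6 ℕ.+ (j ℕ.+ j))                   ≡⟨ hF-even α f (suc (j ℕ.+ j)) (%2-+double 6 j) ⟩
    even-rhs (hF α f) ⌊ 6 ℕ.+ (j ℕ.+ j) /2⌋ ÷ h2 α   ≡⟨ cong (λ i → even-rhs (hF α f) (3 ℕ.+ i) ÷ h2 α) (half-even j) ⟩
    even-rhs (hF α f) (3 ℕ.+ j) ÷ h2 α               ≡⟨ cong (_÷ h2 α) (even-rhs-cong (3 ℕ.+ j) (λ i i≤ → agrees f i
                                                          (below-fuel i≤ (ℕP.+-monoʳ-≤ 4 (step-bound j)) n≤f))) ⟩
    even-rhs closed (3 ℕ.+ j) ÷ h2 α                 ≡⟨ cong (_÷ h2 α) (closed-even j) ⟩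
    (closed n * closed 2) ÷ h2 α                     ≡⟨ cong (λ d → (closed n * d) ÷ h2 α) h2-mono ⟨
    (closed n * h2 α) ÷ h2 α                         ≡⟨ exact-÷ (closed n) (h2 α) h2≢0 ⟩
    closed n                                         ∎
    where
    open ≡-Reasoning
    n : ℕ
    n = 6 ℕ.+ (j ℕ.+ j)

  h-closed : ∀ n → h α n ≡ closed n
  h-closed n = agrees (suc n) n (ℕP.n<1+n n)

  -- The square and cube criteria on a residue class: h_n is a square (cube) iff the fixed
  -- monomial of `residue-form` is, the sign being a unit and the K-th power factor nonzero.
  square-class : ∀ n {s x} → n % 14 ≡ s → {{Unit (sgn s)}} →
    mono (+ 1) (eα s % 2) (eβ s % 2) ≡ x → IsSquare (h α n) ⇔ IsSquare x
  square-class n {s} {x} n%14≡s base≡x = from-form (residue-form 1 n s n%14≡s)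
    where
    from-form : (∃₂ λ c d → closed n ≡ sgn s * (mono (+ 1) (eα s % 2) (eβ s % 2) * mono (+ 1) c d ^ 2)) →
                IsSquare (h α n) ⇔ IsSquare x
    from-form (c , d , h≡) =
      ⇔-trans (≡⇒⇔ IsSquare (trans (h-closed n) h≡))
     (⇔-trans unit-square
     (⇔-trans (square-scale (mono-nonzero α≢0 α≢1 (λ ())))
              (≡⇒⇔ IsSquare base≡x)))

  cube-class : ∀ n {s x} → n % 21 ≡ s → {{Unit (sgn s)}} →
    mono (+ 1) (eα s % 3) (eβ s % 3) ≡ x → IsCube (h α n) ⇔ IsCube x
  cube-class n {s} {x} n%21≡s base≡x = from-form (residue-form 2 n s n%21≡s)
    where
    from-form : (∃₂ λ c d → closed n ≡ sgn s * (mono (+ 1) (eα s % 3) (eβ s % 3) * mono (+ 1) c d ^ 3)) →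
                IsCube (h α n) ⇔ IsCube x
    from-form (c , d , h≡) =
      ⇔-trans (≡⇒⇔ IsCube (trans (h-closed n) h≡))
     (⇔-trans unit-cube
     (⇔-trans (cube-scale (mono-nonzero α≢0 α≢1 (λ ())))
              (≡⇒⇔ IsCube base≡x)))

  part-i : ∀ n → (n % 14 ≡ 2) ⊎ (n % 14 ≡ 3) ⊎ (n % 14 ≡ 11) ⊎ (n % 14 ≡ 12) →
    IsSquare (h α n) ⇔ IsSquare (α - + 1)
  part-i n (inj₁ n≡2) = square-class n n≡2 mono-β
  part-i n (inj₂ (inj₁ n≡3)) = square-class n n≡3 mono-β
  part-i n (inj₂ (inj₂ (inj₁ n≡11))) = square-class n n≡11 mono-β
  part-i n (inj₂ (inj₂ (inj₂ n≡12))) = square-class n n≡12 mono-β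

  part-ii : ∀ n → (n % 14 ≡ 4) ⊎ (n % 14 ≡ 5) ⊎ (n % 14 ≡ 9) ⊎ (n % 14 ≡ 10) →
    IsSquare (h α n) ⇔ IsSquare α
  part-ii n (inj₁ n≡4) = square-class n n≡4 mono-α
  part-ii n (inj₂ (inj₁ n≡5)) = square-class n n≡5 mono-α
  part-ii n (inj₂ (inj₂ (inj₁ n≡9))) = square-class n n≡9 mono-α
  part-ii n (inj₂ (inj₂ (inj₂ n≡10))) = square-class n n≡10 mono-α

  part-iii : ∀ n → (n % 21 ≡ 4) ⊎ (n % 21 ≡ 6) ⊎ (n % 21 ≡ 10) ⊎ (n % 21 ≡ 11) ⊎ (n % 21 ≡ 15) ⊎ (n % 21 ≡ 17) →
    IsCube (h α n) ⇔ IsCube α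
  part-iii n (inj₁ n≡4) = ⇔-trans (cube-class n n≡4 mono-α²) (cube-of-square α≢0)
  part-iii n (inj₂ (inj₁ n≡6)) = cube-class n n≡6 mono-α
  part-iii n (inj₂ (inj₂ (inj₁ n≡10))) = ⇔-trans (cube-class n n≡10 mono-α²) (cube-of-square α≢0)
  part-iii n (inj₂ (inj₂ (inj₂ (inj₁ n≡11)))) = ⇔-trans (cube-class n n≡11 mono-α²) (cube-of-square α≢0)
  part-iii n (inj₂ (inj₂ (inj₂ (inj₂ (inj₁ n≡15))))) = cube-class n n≡15 mono-α
  part-iii n (inj₂ (inj₂ (inj₂ (inj₂ (inj₂ n≡17))))) = ⇔-trans (cube-class n n≡17 mono-α²) (cube-of-square α≢0)

  part-iv : ∀ n → (n % 21 ≡ 9) ⊎ (n % 21 ≡ 12) → IsCube (h α n) ⇔ IsCube (α - + 1)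
  part-iv n (inj₁ n≡9) = cube-class n n≡9 mono-β
  part-iv n (inj₂ n≡12) = cube-class n n≡12 mono-β

theorem5p9 : (α : ℤ) → α ≢ + 0 → α ≢ + 1 → (n : ℕ) →
    (((n % 14 ≡ 2) ⊎ (n % 14 ≡ 3) ⊎ (n % 14 ≡ 11) ⊎ (n % 14 ≡ 12)) →
      (IsSquare (h α n) ⇔ IsSquare (α - + 1)))
    × (((n % 14 ≡ 4) ⊎ (n % 14 ≡ 5) ⊎ (n % 14 ≡ 9) ⊎ (n % 14 ≡ 10)) →
      (IsSquare (h α n) ⇔ IsSquare α))
    × (((n % 21 ≡ 4) ⊎ (n % 21 ≡ 6) ⊎ (n % 21 ≡ 10) ⊎ (n % 21 ≡ 11) ⊎ (n % 21 ≡ 15) ⊎ (n % 21 ≡ 17)) →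
      (IsCube (h α n) ⇔ IsCube α))
    × (((n % 21 ≡ 9) ⊎ (n % 21 ≡ 12)) →
      (IsCube (h α n) ⇔ IsCube (α - + 1)))
theorem5p9 α α≢0 α≢1 n = part-i n , part-ii n , part-iii n , part-iv n
  where open Criteria α α≢0 α≢1
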